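{- Let $(\mathcal P_n)_{n\in\mathbb N}$ be a sequence where each $\mathcal P_n=(C_1,\dots,C_{m_n})$ is an ordered partition of $\{0,1\}^n$, and assume $\max_{i\in[m_n]}|C_i|\in\mathcal O(n)$. Then $|\mathrm{Orbit}_n(\mathcal P_n)|$ grows asymptotically faster than any polynomial in $2^n=|\{0,1\}^n|$.
   Context: $[n]=\{1,\dots,n\}$ and $\mathrm{Sym}_n$ is the symmetric group on $[n]$. $\mathrm{Sym}_n$ acts on $\{0,1\}^n$ by permuting positions: for $v=v_1\cdots v_n$, $\pi(v)=v_{\pi^{ -1}(1)}v_{\pi^{ -1}(2)}\cdots v_{\pi^{ -1}(n)}$; this extends elementwise to sets of strings and componentwise to tuples of such sets. An ordered partition $(C_1,\dots,C_m)$ of $\{0,1\}^n$ is a tuple of pairwise disjoint nonempty sets with union $\{0,1\}^n$ (the colour classes). $\mathrm{Orbit}_n(\mathcal P)=\{\pi(\mathcal P):\pi\in\mathrm{Sym}_n\}$. -}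

module Defs where

open import Data.Bool using (Bool; true; false)
open import Data.Nat using (ℕ; zero; suc; _+_; _*_; _^_; _≤_; _<_)
open import Data.Fin using (Fin)
open import Data.Fin.Properties using (_≟_)
open import Data.Vec using (Vec; []; _∷_; tabulate; lookup)
open import Data.List using (List; []; _∷_; map; _++_; length; filter)
open import Data.Fin.Permutation using (Permutation′; _⟨$⟩ʳ_; _⟨$⟩ˡ_)
open import Data.Product using (Σ; ∃; _×_; _,_)
open import Relation.Binary.PropositionalEquality using (_≡_; _≢_)
open import Relation.Nullary using (¬_)

Str : ℕ → Set
Str n = Vec Bool n

allStrings : (n : ℕ) → List (Str n)
allStrings zero = [] ∷ []
allStrings (suc n) = map (false ∷_) (allStrings n) ++ map (true ∷_) (allStrings n)

-- An ordered partition (C_1,…,C_m) of {0,1}^n, encoded by its colour map: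
-- C_(i+1) = { v | colour v ≡ i } for i : Fin m; nonemptiness of every class
-- is the surjectivity of the colour map. Disjointness and covering are automatic.
record OrderedPartition (n : ℕ) : Set where
  field
    m         : ℕ
    colour    : Str n → Fin m
    nonempty  : (i : Fin m) → ∃ λ v → colour v ≡ i
open OrderedPartition public

classSize : {n : ℕ} (P : OrderedPartition n) → Fin (m P) → ℕ
classSize {n} P i = length (filter (λ v → colour P v ≟ i) (allStrings n))

actStr : {n : ℕ} → Permutation′ n → Str n → Str n
actStr π v = tabulate (λ j → lookup v (π ⟨$⟩ˡ j))

actStrInv : {n : ℕ} → Permutation′ n → Str n → Str n
actStrInv π w = tabulate (λ j → lookup w (π ⟨$⟩ʳ j))

-- Action on ordered partitions (componentwise on the tuple of sets):
-- π(P) = (π(C_1),…,π(C_m)), and w ∈ π(C_i) iff π⁻¹(w) ∈ C_i.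
actColour : {n : ℕ} → Permutation′ n → (P : OrderedPartition n) → Str n → Fin (m P)
actColour π P w = colour P (actStrInv π w)

SameImage : {n : ℕ} → (P : OrderedPartition n) → Permutation′ n → Permutation′ n → Set
SameImage P π σ = ∀ w → actColour π P w ≡ actColour σ P w

OrbitAtLeast : {n : ℕ} → OrderedPartition n → ℕ → Set
OrbitAtLeast {n} P M =
  Σ (Fin M → Permutation′ n) λ f →
    ∀ (a b : Fin M) → SameImage P (f a) (f b) → a ≡ b

{-# OPTIONS --safe #-}
-- Write n = 2^(t+1) q + r and view all but r positions as the vertices of the cube {0,1}^(t+1) times [q].
-- The probe in direction i is the string reading the i-th cube coordinate. A control vector S in
-- {0,1}^(2^t q) chooses, edge by edge, which edges in direction i to flip: flipping in direction j
-- leaves every other probe unchanged, while the probe in direction i, read after the flip, recovers S.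
-- Hence, after any permutation π, the 2^(2^t q) controls yield pairwise distinct images of the probe,
-- and since a colour class has at most s = cn elements, pigeonhole yields 2^((2^t - 1) q) controls whose
-- images have pairwise different colours. Doing this direction by direction gives (2^((2^t - 1) q))^(t+1) permutations
-- whose images of P assign different colours to some probe. With t = 2k+1 and q large this exceeds
-- C (2^n)^k, since (2^t - 1) q (t+1) is roughly (k+1) n while cn + 1 ≤ 2^q.
module Submission where

open import Defs
open import Data.Bool using (Bool; true; false; _xor_)
open import Data.Bool.Properties using (xor-identityʳ; xor-assoc; xor-same) renaming (_≟_ to _≟ᵇ_)
open import Data.Empty using (⊥-elim)
open import Data.Fin as Fin using (Fin; remQuot; combine)
open import Data.Fin.Properties using (combine-remQuot; inject≤-injective; *↔×; +↔⊎; 2↔Bool)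
  renaming (_≟_ to _≟ᶠ_; <⇒≢ to <⇒≢ᶠ)
open import Data.Fin.Permutation using (Permutation′; _⟨$⟩ʳ_; _⟨$⟩ˡ_; _∘ₚ_; inverseʳ; permutation)
import Data.Fin.Permutation as Permutation
open import Data.List using (List; []; _∷_; map; _++_; length; filter)
open import Data.List.Properties using (length-++; length-map; filter-notAll)
open import Data.List.Membership.Propositional using (_∈_)
open import Data.List.Membership.Propositional.Properties
  using (∈-++⁺ˡ; ∈-++⁺ʳ; ∈-map⁺; ∈-map⁻; ∈-filter⁺; ∈-filter⁻)
open import Data.List.Relation.Binary.Subset.Propositional using (_⊆_)
import Data.List.Relation.Unary.Any as Any
open Any using (here; there)
open import Data.List.Relation.Unary.All as All using (All; []; _∷_)
open import Data.List.Relation.Unary.All.Properties using (all-filter)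
  renaming (filter⁺ to All-filter⁺; map⁺ to All-map⁺)
open import Data.List.Relation.Unary.AllPairs using ([]; _∷_)
open import Data.List.Relation.Unary.Unique.Propositional using (Unique)
import Data.List.Relation.Unary.Unique.Propositional.Properties as Unique
open import Data.Nat using (ℕ; zero; suc; _+_; _*_; _^_; _∸_; _≤_; _<_; z≤n; s≤s; s≤s⁻¹; NonZero)
open import Data.Nat.Properties
open import Data.Nat.DivMod using (_/_; _%_; m≡m%n+[m/n]*n; m%n<n; m*n/n≡m; /-monoˡ-≤)
open import Data.Nat.Tactic.RingSolver using (solve-∀)
open import Data.Product using (Σ; ∃; ∃₂; _×_; _,_; proj₁; proj₂; uncurry; map₂)
open import Data.Product.Function.NonDependent.Propositional using (_×-↔_)
open import Data.Sum using (_⊎_; inj₁; inj₂)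
open import Data.Sum.Function.Propositional using (_⊎-↔_)
open import Data.Vec using (Vec; []; _∷_; lookup; tabulate; removeAt; insertAt; updateAt)
open import Data.Vec.Properties
  using (∷-injectiveʳ; ≡-dec; lookup∘tabulate; tabulate-cong; tabulate∘lookup; lookup∘updateAt;
         lookup∘updateAt′; updateAt-updateAt-local; updateAt-id; insertAt-lookup; removeAt-insertAt)
open import Data.Vec.Relation.Binary.Pointwise.Extensional using (ext; Pointwise-≡⇒≡)
open import Function using (_∘_; id; Injective; _↔_; Inverse; mk↔ₛ′)
open import Function.Properties.Inverse using (↔-refl; ↔-trans)
open import Relation.Binary.Definitions using (DecidableEquality)
open import Relation.Binary.PropositionalEquality
open import Relation.Nullary using (¬_; yes; no; ¬?)
open import Relation.Unary using (Decidable)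

-- Counting

∈-allStrings : ∀ {n} (v : Str n) → v ∈ allStrings n
∈-allStrings [] = here refl
∈-allStrings {suc n} (false ∷ v) = ∈-++⁺ˡ (∈-map⁺ (false ∷_) (∈-allStrings v))
∈-allStrings {suc n} (true ∷ v) =
  ∈-++⁺ʳ (map (false ∷_) (allStrings n)) (∈-map⁺ (true ∷_) (∈-allStrings v))

unique-allStrings : ∀ n → Unique (allStrings n)
unique-allStrings zero = [] ∷ []
unique-allStrings (suc n) =
  Unique.++⁺ (Unique.map⁺ ∷-injectiveʳ (unique-allStrings n))
             (Unique.map⁺ ∷-injectiveʳ (unique-allStrings n))
             disjoint
  where
  disjoint : ∀ {v} → ¬ (v ∈ map (false ∷_) (allStrings n) × v ∈ map (true ∷_) (allStrings n))
  disjoint (v∈ , v∈′) with ∈-map⁻ (false ∷_) v∈ | ∈-map⁻ (true ∷_) v∈′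
  ... | _ , _ , refl | _ , _ , ()

length-allStrings : ∀ n → length (allStrings n) ≡ 2 ^ n
length-allStrings zero = refl
length-allStrings (suc n) = begin
  length (map (false ∷_) (allStrings n) ++ map (true ∷_) (allStrings n))
    ≡⟨ length-++ (map (false ∷_) (allStrings n)) ⟩
  length (map (false ∷_) (allStrings n)) + length (map (true ∷_) (allStrings n))
    ≡⟨ cong₂ _+_ (length-map (false ∷_) (allStrings n)) (length-map (true ∷_) (allStrings n)) ⟩
  length (allStrings n) + length (allStrings n)
    ≡⟨ cong₂ _+_ (length-allStrings n) (trans (length-allStrings n) (sym (+-identityʳ _))) ⟩
  2 ^ suc n
    ∎
  where open ≡-Reasoning

length-filter+filter-¬ : ∀ {A : Set} {Q : A → Set} (Q? : Decidable Q) xs →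
  length (filter Q? xs) + length (filter (¬? ∘ Q?) xs) ≡ length xs
length-filter+filter-¬ Q? [] = refl
length-filter+filter-¬ Q? (x ∷ xs) with Q? x
... | yes _ = cong suc (length-filter+filter-¬ Q? xs)
... | no  _ = trans (+-suc _ _) (cong suc (length-filter+filter-¬ Q? xs))

Unique∧⊆⇒length≤ : ∀ {A : Set} → DecidableEquality A →
  ∀ {xs} ys → Unique xs → xs ⊆ ys → length xs ≤ length ys
Unique∧⊆⇒length≤ _≟_ {[]} ys _ _ = z≤n
Unique∧⊆⇒length≤ _≟_ {x ∷ xs} ys (x∉xs ∷ xs!) xs⊆ys = begin
  suc (length xs)               ≤⟨ s≤s (Unique∧⊆⇒length≤ _≟_ (filter ≢x? ys) xs! xs⊆ys-x) ⟩
  suc (length (filter ≢x? ys))  ≤⟨ filter-notAll ≢x? ys (Any.map (λ { refl x≢x → x≢x refl }) (xs⊆ys (here refl))) ⟩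
  length ys                     ∎
  where
  open ≤-Reasoning
  ≢x? : Decidable (λ y → ¬ y ≡ x)
  ≢x? y = ¬? (y ≟ x)
  xs⊆ys-x : xs ⊆ filter ≢x? ys
  xs⊆ys-x y∈xs = ∈-filter⁺ ≢x? (xs⊆ys (there y∈xs)) (λ { refl → All.lookup x∉xs y∈xs refl })

unique⇒length≤classSize : ∀ {n} (P : OrderedPartition n) i (ws : List (Str n)) →
  Unique ws → All (λ w → colour P w ≡ i) ws → length ws ≤ classSize P i
unique⇒length≤classSize P i ws ws! coloured-i =
  Unique∧⊆⇒length≤ (≡-dec _≟ᵇ_) _ ws! λ w∈ws →
    ∈-filter⁺ (λ v → colour P v ≟ᶠ i) (∈-allStrings _) (All.lookup coloured-i w∈ws)

module _ {A B : Set} (_≟_ : DecidableEquality B) (κ : A → B) (s : ℕ)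
  (fibre≤ : ∀ b xs → Unique xs → All (λ x → κ x ≡ b) xs → length xs ≤ s) where

  pigeonhole : ∀ M xs → Unique xs → suc s * M ≤ length xs →
    Σ (Fin M → A) λ f → (∀ a → f a ∈ xs) × (∀ a a′ → κ (f a) ≡ κ (f a′) → a ≡ a′)
  pigeonhole zero xs _ _ = (λ ()) , (λ ()) , (λ ())
  pigeonhole (suc M) (x ∷ xs) (x∉xs ∷ xs!) room = f , f∈ , f-separates
    where
    like-x? : Decidable (λ y → κ y ≡ κ x)
    like-x? y = κ y ≟ κ x
    same = filter like-x? xs
    others = filter (¬? ∘ like-x?) xs

    room′ : suc s * M ≤ length others
    room′ = +-cancelˡ-≤ (suc s) _ _ (begin
      suc s + suc s * M                  ≡⟨ *-suc (suc s) M ⟨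
      suc s * suc M                      ≤⟨ room ⟩
      suc (length xs)                    ≡⟨ cong suc (length-filter+filter-¬ like-x? xs) ⟨
      suc (length same) + length others  ≤⟨ +-monoˡ-≤ _ (fibre≤ (κ x) (x ∷ same)
                                              (All-filter⁺ like-x? x∉xs ∷ Unique.filter⁺ like-x? xs!)
                                              (refl ∷ all-filter like-x? xs)) ⟩
      s + length others                  ≤⟨ +-monoˡ-≤ _ (n≤1+n s) ⟩
      suc s + length others              ∎)
      where open ≤-Reasoning

    rest = pigeonhole M others (Unique.filter⁺ _ xs!) room′
    g = proj₁ rest

    g-others : ∀ a → g a ∈ xs × ¬ κ (g a) ≡ κ x
    g-others a = ∈-filter⁻ (¬? ∘ like-x?) {xs = xs} (proj₁ (proj₂ rest) a)

    f : Fin (suc M) → A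
    f Fin.zero = x
    f (Fin.suc a) = g a

    f∈ : ∀ a → f a ∈ x ∷ xs
    f∈ Fin.zero = here refl
    f∈ (Fin.suc a) = there (proj₁ (g-others a))

    f-separates : ∀ a a′ → κ (f a) ≡ κ (f a′) → a ≡ a′
    f-separates Fin.zero Fin.zero _ = refl
    f-separates Fin.zero (Fin.suc a′) eq = ⊥-elim (proj₂ (g-others a′) (sym eq))
    f-separates (Fin.suc a) Fin.zero eq = ⊥-elim (proj₂ (g-others a) eq)
    f-separates (Fin.suc a) (Fin.suc a′) eq = cong Fin.suc (proj₂ (proj₂ rest) a a′ eq)

module _ {Q A B : Set} {M : ℕ} where

  separatedLeaves : ∀ {L} (step : Fin L → Q → A → Q) (observe : Fin L → Q → B) →
    (∀ i q → Σ (Fin M → A) λ f →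
       ∀ a a′ → observe i (step i q (f a)) ≡ observe i (step i q (f a′)) → a ≡ a′) →
    (∀ {i j} → j Fin.< i → ∀ q x → observe i (step j q x) ≡ observe i q) →
    Q → Σ (Fin (M ^ L) → Q) λ leaf → ∀ a a′ → (∀ i → observe i (leaf a) ≡ observe i (leaf a′)) → a ≡ a′
  separatedLeaves {zero} step observe separate stable q = (λ _ → q) , λ { Fin.zero Fin.zero _ → refl }
  separatedLeaves {suc L} step observe separate stable q = leaf , leaf-separates
    where
    inner = separatedLeaves (step ∘ Fin.suc) (observe ∘ Fin.suc) (separate ∘ Fin.suc) (stable ∘ s≤s) q

    -- The step at level zero is taken last, so by stability it keeps the observations
    -- at the higher levels, which already separate the inner leaves.
    leaf′ : Fin M × Fin (M ^ L) → Q
    leaf′ (m , a) = step Fin.zero (proj₁ inner a) (proj₁ (separate Fin.zero (proj₁ inner a)) m)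

    leaf′-separates : ∀ b b′ → (∀ i → observe i (leaf′ b) ≡ observe i (leaf′ b′)) → b ≡ b′
    leaf′-separates (m , a) (m′ , a′) same
      with proj₂ inner a a′ (λ i →
             trans (sym (stable (s≤s z≤n) _ _)) (trans (same (Fin.suc i)) (stable (s≤s z≤n) _ _)))
    ... | refl = cong (_, a) (proj₂ (separate Fin.zero (proj₁ inner a)) m m′ (same Fin.zero))

    leaf : Fin (M ^ suc L) → Q
    leaf = leaf′ ∘ remQuot {M} (M ^ L)

    leaf-separates : ∀ a a′ → (∀ i → observe i (leaf a) ≡ observe i (leaf a′)) → a ≡ a′
    leaf-separates a a′ same = begin
      a                                         ≡⟨ combine-remQuot {M} (M ^ L) a ⟨
      uncurry combine (remQuot {M} (M ^ L) a)   ≡⟨ cong (uncurry combine) (leaf′-separates _ _ same) ⟩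
      uncurry combine (remQuot {M} (M ^ L) a′)  ≡⟨ combine-remQuot {M} (M ^ L) a′ ⟩
      a′                                        ∎
      where open ≡-Reasoning

-- Separating families

actStrInv-∘ₚ : ∀ {n} (π ρ : Permutation′ n) w → actStrInv (π ∘ₚ ρ) w ≡ actStrInv π (actStrInv ρ w)
actStrInv-∘ₚ π ρ w = tabulate-cong λ j → sym (lookup∘tabulate _ (π ⟨$⟩ʳ j))

actStr-actStrInv : ∀ {n} (π : Permutation′ n) w → actStr π (actStrInv π w) ≡ w
actStr-actStrInv π w = begin
  tabulate (λ j → lookup (actStrInv π w) (π ⟨$⟩ˡ j))  ≡⟨ tabulate-cong (λ j → lookup∘tabulate _ (π ⟨$⟩ˡ j)) ⟩
  tabulate (λ j → lookup w (π ⟨$⟩ʳ (π ⟨$⟩ˡ j)))       ≡⟨ tabulate-cong (λ j → cong (lookup w) (inverseʳ π)) ⟩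
  tabulate (lookup w)                                 ≡⟨ tabulate∘lookup w ⟩
  w                                                   ∎
  where open ≡-Reasoning

actStrInv-injective : ∀ {n} (π : Permutation′ n) → Injective _≡_ _≡_ (actStrInv π)
actStrInv-injective π {w} {w′} eq = begin
  w                           ≡⟨ actStr-actStrInv π w ⟨
  actStr π (actStrInv π w)    ≡⟨ cong (actStr π) eq ⟩
  actStr π (actStrInv π w′)   ≡⟨ actStr-actStrInv π w′ ⟩
  w′                          ∎
  where open ≡-Reasoning

record SeparatingFamily (n p L : ℕ) : Set where
  field
    probe             : Fin L → Str n
    shuffle           : Fin L → Vec Bool p → Permutation′ n
    shuffle-preserves : ∀ {i j} → j Fin.< i → ∀ S → actStrInv (shuffle j S) (probe i) ≡ probe i
    shuffle-injective : ∀ i → Injective _≡_ _≡_ (λ S → actStrInv (shuffle i S) (probe i))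

module _ {n p L} (F : SeparatingFamily n p L) (P : OrderedPartition n) {s M : ℕ}
  (small : ∀ i → classSize P i ≤ s) (room : suc s * M ≤ 2 ^ p) where
  open SeparatingFamily F

  private
    step : Fin L → Permutation′ n → Vec Bool p → Permutation′ n
    step i π S = π ∘ₚ shuffle i S

    observe : Fin L → Permutation′ n → Fin (m P)
    observe i π = actColour π P (probe i)

    observe-stable : ∀ {i j} → j Fin.< i → ∀ π S → observe i (step j π S) ≡ observe i π
    observe-stable {i} {j} j<i π S = cong (colour P) (begin
      actStrInv (π ∘ₚ shuffle j S) (probe i)           ≡⟨ actStrInv-∘ₚ π (shuffle j S) (probe i) ⟩
      actStrInv π (actStrInv (shuffle j S) (probe i))  ≡⟨ cong (actStrInv π) (shuffle-preserves j<i S) ⟩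
      actStrInv π (probe i)                            ∎)
      where open ≡-Reasoning

    separate : ∀ i π → Σ (Fin M → Vec Bool p) λ f →
      ∀ a a′ → observe i (step i π (f a)) ≡ observe i (step i π (f a′)) → a ≡ a′
    separate i π = map₂ proj₂ (pigeonhole _≟ᶠ_ (colour P ∘ image) s fibre≤ M
      (allStrings p) (unique-allStrings p) (subst (suc s * M ≤_) (sym (length-allStrings p)) room))
      where
      image : Vec Bool p → Str n
      image S = actStrInv (step i π S) (probe i)

      image-injective : Injective _≡_ _≡_ image
      image-injective {S} {S′} eq = shuffle-injective i (actStrInv-injective π (begin
        actStrInv π (actStrInv (shuffle i S) (probe i))   ≡⟨ actStrInv-∘ₚ π (shuffle i S) (probe i) ⟨
        image S                                           ≡⟨ eq ⟩
        image S′                                          ≡⟨ actStrInv-∘ₚ π (shuffle i S′) (probe i) ⟩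
        actStrInv π (actStrInv (shuffle i S′) (probe i))  ∎))
        where open ≡-Reasoning

      fibre≤ : ∀ c Ss → Unique Ss → All (λ S → colour P (image S) ≡ c) Ss → length Ss ≤ s
      fibre≤ c Ss Ss! coloured-c = begin
        length Ss              ≡⟨ length-map image Ss ⟨
        length (map image Ss)  ≤⟨ unique⇒length≤classSize P c _ (Unique.map⁺ image-injective Ss!)
                                                                 (All-map⁺ coloured-c) ⟩
        classSize P c          ≤⟨ small c ⟩
        s                      ∎
        where open ≤-Reasoning

  separatingFamily⇒orbitAtLeast : OrbitAtLeast P (M ^ L)
  separatingFamily⇒orbitAtLeast =
    map₂ (λ separated a a′ same → separated a a′ (λ i → same (probe i)))
         (separatedLeaves step observe separate observe-stable Permutation.id)

orbitAtLeast-≤ : ∀ {n} (P : OrderedPartition n) {M M′} → M′ ≤ M → OrbitAtLeast P M → OrbitAtLeast P M′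
orbitAtLeast-≤ P M′≤M (f , f-separates) =
  (λ a → f (Fin.inject≤ a M′≤M)) , λ a a′ same → inject≤-injective M′≤M M′≤M a a′ (f-separates _ _ same)

-- The hypercube family

removeAt-updateAt : ∀ {A : Set} {n} (xs : Vec A (suc n)) i {f : A → A} →
  removeAt (updateAt xs i f) i ≡ removeAt xs i
removeAt-updateAt (x ∷ xs) Fin.zero = refl
removeAt-updateAt (x ∷ y ∷ ys) (Fin.suc Fin.zero) = refl
removeAt-updateAt (x ∷ y ∷ ys) (Fin.suc (Fin.suc i)) = cong (x ∷_) (removeAt-updateAt (y ∷ ys) (Fin.suc i))

Fin2^↔Vec : ∀ t → Fin (2 ^ t) ↔ Vec Bool t
Fin2^↔Vec zero = mk↔ₛ′ (λ _ → []) (λ _ → Fin.zero) (λ { [] → refl }) (λ { Fin.zero → refl ; (Fin.suc ()) })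
Fin2^↔Vec (suc t) = ↔-trans *↔× (↔-trans (2↔Bool ×-↔ Fin2^↔Vec t) ×↔∷)
  where
  ×↔∷ : (Bool × Vec Bool t) ↔ Vec Bool (suc t)
  ×↔∷ = mk↔ₛ′ (uncurry _∷_) (λ { (b ∷ bs) → b , bs }) (λ { (b ∷ bs) → refl }) (λ _ → refl)

cube↔ : ∀ t q → Fin (2 ^ t * q) ↔ (Vec Bool t × Fin q)
cube↔ t q = ↔-trans *↔× (Fin2^↔Vec t ×-↔ ↔-refl)

module _ {n} {X : Set} (e : Fin n ↔ X) where
  open Inverse e

  label : (X → Bool) → Str n
  label V = tabulate (V ∘ to)

  label-injective : ∀ {V V′} → label V ≡ label V′ → ∀ y → V y ≡ V′ y
  label-injective {V} {V′} eq y = begin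
    V y                          ≡⟨ cong V (strictlyInverseˡ y) ⟨
    V (to (from y))              ≡⟨ lookup∘tabulate (V ∘ to) (from y) ⟨
    lookup (label V) (from y)    ≡⟨ cong (λ w → lookup w (from y)) eq ⟩
    lookup (label V′) (from y)   ≡⟨ lookup∘tabulate (V′ ∘ to) (from y) ⟩
    V′ (to (from y))             ≡⟨ cong V′ (strictlyInverseˡ y) ⟩
    V′ y                         ∎
    where open ≡-Reasoning

  conjugate : (σ : X → X) → (∀ y → σ (σ y) ≡ y) → Permutation′ n
  conjugate σ σ-involutive = permutation f f f-involutive f-involutive
    where
    f : Fin n → Fin n
    f = from ∘ σ ∘ to
    f-involutive : ∀ x → f (f x) ≡ x
    f-involutive x = begin
      from (σ (to (from (σ (to x)))))  ≡⟨ cong (from ∘ σ) (strictlyInverseˡ (σ (to x))) ⟩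
      from (σ (σ (to x)))              ≡⟨ cong from (σ-involutive (to x)) ⟩
      from (to x)                      ≡⟨ strictlyInverseʳ x ⟩
      x                                ∎
      where open ≡-Reasoning

  actStrInv-conjugate : ∀ σ σ-involutive V →
    actStrInv (conjugate σ σ-involutive) (label V) ≡ label (V ∘ σ)
  actStrInv-conjugate σ _ V = tabulate-cong λ x →
    trans (lookup∘tabulate (V ∘ to) _) (cong V (strictlyInverseˡ (σ (to x))))

module Hypercube (t q r : ℕ) where

  Position : Set
  Position = (Vec Bool (suc t) × Fin q) ⊎ Fin r

  coordinates : Fin (2 ^ suc t * q + r) ↔ Position
  coordinates = ↔-trans +↔⊎ (cube↔ (suc t) q ⊎-↔ ↔-refl)

  Control : Set
  Control = Vec Bool (2 ^ t * q)

  -- An edge in direction i is named by either of its endpoints with the i-th coordinate deleted.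
  edge : Fin (suc t) → Vec Bool (suc t) → Fin q → Fin (2 ^ t * q)
  edge i b x = Inverse.from (cube↔ t q) (removeAt b i , x)

  bit : Fin (suc t) → Position → Bool
  bit i (inj₁ (b , _)) = lookup b i
  bit i (inj₂ _)       = false

  toggle : Fin (suc t) → Control → Position → Position
  toggle i S (inj₁ (b , x)) = inj₁ (updateAt b i (lookup S (edge i b x) xor_) , x)
  toggle i S (inj₂ z)       = inj₂ z

  toggle-involutive : ∀ i S y → toggle i S (toggle i S y) ≡ y
  toggle-involutive i S (inj₁ (b , x)) = cong (λ b′ → inj₁ (b′ , x)) (begin
    updateAt (updateAt b i (c xor_)) i (c′ xor_)  ≡⟨ cong (λ d → updateAt (updateAt b i (c xor_)) i (d xor_)) c′≡c ⟩
    updateAt (updateAt b i (c xor_)) i (c xor_)   ≡⟨ updateAt-updateAt-local i b (xor-cancelˡ c (lookup b i)) ⟩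
    updateAt b i id                               ≡⟨ updateAt-id i b ⟩
    b                                             ∎)
    where
    open ≡-Reasoning
    c = lookup S (edge i b x)
    c′ = lookup S (edge i (updateAt b i (c xor_)) x)
    c′≡c : c′ ≡ c
    c′≡c = cong (λ b′ → lookup S (Inverse.from (cube↔ t q) (b′ , x))) (removeAt-updateAt b i)
    xor-cancelˡ : ∀ c y → c xor (c xor y) ≡ y
    xor-cancelˡ c y = trans (sym (xor-assoc c c y)) (cong (_xor y) (xor-same c))
  toggle-involutive i S (inj₂ z) = refl

  bit-toggle-≢ : ∀ {i j} → i ≢ j → ∀ S y → bit i (toggle j S y) ≡ bit i y
  bit-toggle-≢ {i} {j} i≢j S (inj₁ (b , x)) = lookup∘updateAt′ i j i≢j b
  bit-toggle-≢ i≢j S (inj₂ z) = refl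

  bit-toggle-insertAt : ∀ i S b x →
    bit i (toggle i S (inj₁ (insertAt b i false , x))) ≡ lookup S (Inverse.from (cube↔ t q) (b , x))
  bit-toggle-insertAt i S b x = begin
    lookup (updateAt b′ i (c xor_)) i             ≡⟨ lookup∘updateAt i b′ ⟩
    c xor lookup b′ i                             ≡⟨ cong (c xor_) (insertAt-lookup b i false) ⟩
    c xor false                                   ≡⟨ xor-identityʳ c ⟩
    c                                             ≡⟨ cong (λ b″ → lookup S (Inverse.from (cube↔ t q) (b″ , x)))
                                                          (removeAt-insertAt b i false) ⟩
    lookup S (Inverse.from (cube↔ t q) (b , x))   ∎
    where
    open ≡-Reasoning
    b′ = insertAt b i false
    c = lookup S (edge i b′ x)

  toggle-injective : ∀ i {S S′} → (∀ y → bit i (toggle i S y) ≡ bit i (toggle i S′ y)) → S ≡ S′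
  toggle-injective i {S} {S′} same = Pointwise-≡⇒≡ (ext λ k → begin
    lookup S k                                        ≡⟨ cong (lookup S) (Inverse.strictlyInverseʳ (cube↔ t q) k) ⟨
    lookup S (Inverse.from (cube↔ t q) (b k , x k))   ≡⟨ bit-toggle-insertAt i S (b k) (x k) ⟨
    bit i (toggle i S (y k))                          ≡⟨ same (y k) ⟩
    bit i (toggle i S′ (y k))                         ≡⟨ bit-toggle-insertAt i S′ (b k) (x k) ⟩
    lookup S′ (Inverse.from (cube↔ t q) (b k , x k))  ≡⟨ cong (lookup S′) (Inverse.strictlyInverseʳ (cube↔ t q) k) ⟩
    lookup S′ k                                       ∎)
    where
    open ≡-Reasoning
    b = proj₁ ∘ Inverse.to (cube↔ t q)
    x = proj₂ ∘ Inverse.to (cube↔ t q)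
    y = λ k → inj₁ (insertAt (b k) i false , x k)

  separatingFamily : SeparatingFamily (2 ^ suc t * q + r) (2 ^ t * q) (suc t)
  separatingFamily = record
    { probe             = probe
    ; shuffle           = shuffle
    ; shuffle-preserves = λ {i} {j} j<i S → begin
        actStrInv (shuffle j S) (probe i)       ≡⟨ shuffle-probe j S i ⟩
        label coordinates (bit i ∘ toggle j S)  ≡⟨ tabulate-cong (λ x →
                                                     bit-toggle-≢ (≢-sym (<⇒≢ᶠ j<i)) S (Inverse.to coordinates x)) ⟩
        probe i                                 ∎
    ; shuffle-injective = λ i {S} {S′} eq → toggle-injective i (label-injective coordinates (begin
        label coordinates (bit i ∘ toggle i S)   ≡⟨ shuffle-probe i S i ⟨
        actStrInv (shuffle i S) (probe i)        ≡⟨ eq ⟩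
        actStrInv (shuffle i S′) (probe i)       ≡⟨ shuffle-probe i S′ i ⟩
        label coordinates (bit i ∘ toggle i S′)  ∎))
    }
    where
    open ≡-Reasoning
    probe : Fin (suc t) → Str (2 ^ suc t * q + r)
    probe i = label coordinates (bit i)
    shuffle : Fin (suc t) → Control → Permutation′ (2 ^ suc t * q + r)
    shuffle j S = conjugate coordinates (toggle j S) (toggle-involutive j S)
    shuffle-probe : ∀ j S i → actStrInv (shuffle j S) (probe i) ≡ label coordinates (bit i ∘ toggle j S)
    shuffle-probe j S i = actStrInv-conjugate coordinates (toggle j S) (toggle-involutive j S) (bit i)

orbitAtLeast-hypercube : ∀ {n s} (P : OrderedPartition n) t q r → 2 ^ suc t * q + r ≡ n →
  (∀ i → classSize P i ≤ s) → s < 2 ^ q → OrbitAtLeast P ((2 ^ ((2 ^ t ∸ 1) * q)) ^ suc t)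
orbitAtLeast-hypercube {s = s} P t q r refl small s<2^q =
  separatingFamily⇒orbitAtLeast (Hypercube.separatingFamily t q r) P small (begin
    suc s * 2 ^ (u * q)  ≤⟨ *-monoˡ-≤ (2 ^ (u * q)) s<2^q ⟩
    2 ^ q * 2 ^ (u * q)  ≡⟨ ^-distribˡ-+-* 2 q (u * q) ⟨
    2 ^ (suc u * q)      ≡⟨ cong (λ h → 2 ^ (h * q)) (m+[n∸m]≡n (m^n>0 2 t)) ⟩
    2 ^ (2 ^ t * q)      ∎)
  where
  open ≤-Reasoning
  u = 2 ^ t ∸ 1

-- Arithmetic

n<2^n : ∀ n → n < 2 ^ n
n<2^n zero = s≤s z≤n
n<2^n (suc n) = begin-strict
  1 + n          <⟨ +-mono-≤-< (m^n>0 2 n) (n<2^n n) ⟩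
  2 ^ n + 2 ^ n  ≡⟨ cong (2 ^ n +_) (+-identityʳ (2 ^ n)) ⟨
  2 ^ suc n      ∎
  where open ≤-Reasoning

a*[1+q]<2^q : ∀ a q → a + a * a ≤ q → a * suc q < 2 ^ q
a*[1+q]<2^q a q a+a²≤q = subst (λ q → a * suc q < 2 ^ q) (m+[n∸m]≡n a≤q) (begin
  suc (a * suc (a + y))    ≡⟨ expand a y ⟩
  a * a + suc (a * y + a)  ≤⟨ +-monoˡ-≤ _ a²≤y ⟩
  y + suc (a * y + a)      ≡⟨ factor a y ⟩
  suc a * suc y            ≤⟨ *-mono-≤ (n<2^n a) (n<2^n y) ⟩
  2 ^ a * 2 ^ y            ≡⟨ ^-distribˡ-+-* 2 a y ⟨
  2 ^ (a + y)              ∎)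
  where
  open ≤-Reasoning
  a≤q = ≤-trans (m≤m+n a (a * a)) a+a²≤q
  y = q ∸ a
  a²≤y : a * a ≤ y
  a²≤y = +-cancelˡ-≤ a _ _ (subst (a + a * a ≤_) (sym (m+[n∸m]≡n a≤q)) a+a²≤q)
  expand : ∀ a y → suc (a * suc (a + y)) ≡ a * a + suc (a * y + a)
  expand = solve-∀
  factor : ∀ a y → y + suc (a * y + a) ≡ suc a * suc y
  factor = solve-∀

C*2^e<2^[C+e] : ∀ C e → C * 2 ^ e < 2 ^ (C + e)
C*2^e<2^[C+e] C e = begin
  suc (C * 2 ^ e)   ≤⟨ +-monoˡ-≤ (C * 2 ^ e) (m^n>0 2 e) ⟩
  suc C * 2 ^ e     ≤⟨ *-monoˡ-≤ (2 ^ e) (n<2^n C) ⟩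
  2 ^ C * 2 ^ e     ≡⟨ ^-distribˡ-+-* 2 C e ⟨
  2 ^ (C + e)       ∎
  where open ≤-Reasoning

m<[1+m/n]*n : ∀ m n .{{_ : NonZero n}} → m < suc (m / n) * n
m<[1+m/n]*n m n = begin-strict
  m                  ≡⟨ m≡m%n+[m/n]*n m n ⟩
  m % n + m / n * n  <⟨ +-monoˡ-< (m / n * n) (m%n<n m n) ⟩
  n + m / n * n      ∎
  where open ≤-Reasoning

-- Writing u = 1 + 2k + u′ and q = C + 1 + 2k + q′, the right side minus the left is a polynomial
-- in k, C, u′, q′ with nonnegative coefficients.
C+2[1+u][1+q]k≤uq[2+2k] : ∀ k C u q → suc (2 * k) ≤ u → C + suc (2 * k) ≤ q →
  C + 2 * suc u * suc q * k ≤ u * q * suc (suc (2 * k))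
C+2[1+u][1+q]k≤uq[2+2k] k C u q u≥ q≥ =
  subst₂ (λ u q → C + 2 * suc u * suc q * k ≤ u * q * suc (suc (2 * k)))
    (m+[n∸m]≡n u≥) (m+[n∸m]≡n q≥) (shifted (u ∸ suc (2 * k)) (q ∸ (C + suc (2 * k))))
  where
  shifted : ∀ u′ q′ → C + 2 * suc (suc (2 * k) + u′) * suc (C + suc (2 * k) + q′) * k
                      ≤ (suc (2 * k) + u′) * (C + suc (2 * k) + q′) * suc (suc (2 * k))
  shifted u′ q′ = ≤-trans (m≤m+n _ _) (≤-reflexive (sym (split k C u′ q′)))
    where
    split : ∀ k C u′ q′ → (suc (2 * k) + u′) * (C + suc (2 * k) + q′) * suc (suc (2 * k))
      ≡ (C + 2 * suc (suc (2 * k) + u′) * suc (C + suc (2 * k) + q′) * k)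
        + (2 * k * C + C + 2 * k + 2 + (2 * k + 2) * q′ + (2 * k + 2) * u′ + 2 * u′ * C + 2 * u′ * q′)
    split = solve-∀

c*n<2^q : ∀ c D n q → n ≤ suc q * D → c * D + c * D * (c * D) ≤ q → c * n < 2 ^ q
c*n<2^q c D n q n≤ q≥ = begin-strict
  c * n            ≤⟨ *-monoʳ-≤ c n≤ ⟩
  c * (suc q * D)  ≡⟨ cong (c *_) (*-comm (suc q) D) ⟩
  c * (D * suc q)  ≡⟨ *-assoc c D (suc q) ⟨
  c * D * suc q    <⟨ a*[1+q]<2^q (c * D) q q≥ ⟩
  2 ^ q            ∎
  where open ≤-Reasoning

C[2^n]^k<hypercubeOrbit : ∀ k C n q → n ≤ suc q * 2 ^ suc (suc (2 * k)) → C + suc (2 * k) ≤ q →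
  C * (2 ^ n) ^ k < (2 ^ ((2 ^ suc (2 * k) ∸ 1) * q)) ^ suc (suc (2 * k))
C[2^n]^k<hypercubeOrbit k C n q n≤ q≥ = begin-strict
  C * (2 ^ n) ^ k    ≡⟨ cong (C *_) (^-*-assoc 2 n k) ⟩
  C * 2 ^ (n * k)    <⟨ C*2^e<2^[C+e] C (n * k) ⟩
  2 ^ (C + n * k)    ≤⟨ ^-monoʳ-≤ 2 exponent≤ ⟩
  2 ^ (u * q * T)    ≡⟨ ^-*-assoc 2 (u * q) T ⟨
  (2 ^ (u * q)) ^ T  ∎
  where
  open ≤-Reasoning
  t = suc (2 * k)
  T = suc t
  u = 2 ^ t ∸ 1
  1+u≡2^t : suc u ≡ 2 ^ t
  1+u≡2^t = m+[n∸m]≡n (m^n>0 2 t)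
  n≤′ : n ≤ 2 * suc u * suc q
  n≤′ = ≤-trans n≤ (≤-reflexive (trans (cong (λ h → suc q * (2 * h)) (sym 1+u≡2^t)) (*-comm (suc q) _)))
  exponent≤ : C + n * k ≤ u * q * T
  exponent≤ = ≤-trans (+-monoʳ-≤ C (*-monoˡ-≤ k n≤′))
    (C+2[1+u][1+q]k≤uq[2+2k] k C u q (s≤s⁻¹ (subst (T ≤_) (sym 1+u≡2^t) (n<2^n t))) q≥)

theorem13 : (P : (n : ℕ) → OrderedPartition n)
    → (∃₂ λ c N₀ → ∀ n → N₀ ≤ n → ∀ (i : Fin (m (P n))) → classSize (P n) i ≤ c * n)
    → ∀ (k C : ℕ) → ∃ λ N → ∀ n → N ≤ n → OrbitAtLeast (P n) (suc (C * (2 ^ n) ^ k))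
theorem13 P (c , N₀ , small) k C = N₀ + Q₀ * D , large
  where
  t = suc (2 * k)
  D = 2 ^ suc t
  instance
    D≢0 : NonZero D
    D≢0 = m^n≢0 2 (suc t)
  Qʳ = c * D + c * D * (c * D)
  Qᵍ = C + t
  Q₀ = Qʳ + Qᵍ

  large : ∀ n → N₀ + Q₀ * D ≤ n → OrbitAtLeast (P n) (suc (C * (2 ^ n) ^ k))
  large n N≤n = orbitAtLeast-≤ (P n) (C[2^n]^k<hypercubeOrbit k C n q n≤ (≤-trans (m≤n+m Qᵍ Qʳ) Q₀≤q))
    (orbitAtLeast-hypercube (P n) t q (n % D) n≡ (small n (≤-trans (m≤m+n N₀ _) N≤n))
      (c*n<2^q c D n q n≤ (≤-trans (m≤m+n Qʳ Qᵍ) Q₀≤q)))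
    where
    q = n / D
    n≤ : n ≤ suc q * D
    n≤ = <⇒≤ (m<[1+m/n]*n n D)
    n≡ : D * q + n % D ≡ n
    n≡ = trans (+-comm (D * q) _) (trans (cong (n % D +_) (*-comm D q)) (sym (m≡m%n+[m/n]*n n D)))
    Q₀≤q : Q₀ ≤ q
    Q₀≤q = subst (_≤ q) (m*n/n≡m Q₀ D) (/-monoˡ-≤ D (≤-trans (m≤n+m (Q₀ * D) N₀) N≤n))
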